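{- For every $Q>0$ there exists a finite sequence $\sigma$ of positive rational numbers with $\nu(\sigma)=0$ that contains a non-integer element $p/q$ with $\gcd(p,q)=1$ and $q>Q$.
   Context: For a finite sequence $(a_1,\dots,a_N)$ (repetitions allowed), $\nu(a_1,\dots,a_N)=\big(\sum a_i\big)^2-\sum a_i^3$. -}

module Defs where

open import Data.Rational using (ℚ; _+_; _*_; _-_; 0ℚ)
open import Data.List using (List; foldr; map)

sumℚ : List ℚ → ℚ
sumℚ = foldr _+_ 0ℚ

ν : List ℚ → ℚ
ν σ = sumℚ σ * sumℚ σ - sumℚ (map (λ a → a * a * a) σ)

{-# OPTIONS --safe #-}
-- Since x³ + y³ = (x + y)(x² − xy + y²), a pair (x, y) with x + y ≠ 0 has ν(x, y) = 0 exactly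
-- when x + y = x² − xy + y², i.e. 4s = s² + 3t² for s = x + y and t = x − y. This conic has
-- the rational points s = 4 − 1/D, t = (2k + 1)/D with D = 3k² + 3k + 1 the centred hexagonal
-- numbers, because 3(2k + 1)² + 1 = 4D. They give x = (2D + k)/D and y = (2k + 1)(3k + 1)/D;
-- every common divisor of 2D + k and D divides k, hence also 1 = D − 3k(k + 1), so x is in
-- lowest terms, with denominator D > k.
module Submission where

open import Defs
open import Data.Nat using (ℕ; NonZero)
open import Data.Nat.Coprimality using (Coprime)
open import Data.Integer using (ℤ; ∣_∣; +_)
open import Data.Rational using (ℚ; 0ℚ; _<_; _/_)
open import Data.List using (List)
open import Data.List.Relation.Unary.All using (All)
open import Data.List.Membership.Propositional using (_∈_)
open import Data.Product using (Σ; ∃; _×_)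
open import Relation.Nullary using (¬_)
open import Relation.Binary.PropositionalEquality using (_≡_)

open import Data.Nat using (suc)
import Data.Nat as ℕ
import Data.Nat.Properties as ℕ
open import Data.Nat.Divisibility using (_∣_; ∣1⇒≡1; ∣m+n∣m⇒∣n; ∣m⇒∣m*n; ∣n⇒∣m*n)
import Data.Nat.Coprimality as Coprime
import Data.Nat.Solver as ℕ-Solver
import Data.Integer as ℤ
import Data.Integer.Properties as ℤ
import Data.Integer.Solver as ℤ-Solver
import Data.Rational as ℚ
import Data.Rational.Properties as ℚ
import Data.Rational.Unnormalised as ℚᵘ
import Data.Rational.Unnormalised.Properties as ℚᵘ
open import Data.List using ([]; _∷_)
import Data.List.Relation.Unary.All as All
open import Data.List.Relation.Unary.Any using (here)
open import Data.Product using (_,_)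
open import Relation.Binary.PropositionalEquality
  using (refl; sym; trans; cong; cong₂; subst; subst₂; module ≡-Reasoning)

square≡sumOfCubes⇒ν≡0 : ∀ x y →
  (x ℚ.+ y) ℚ.* (x ℚ.+ y) ≡ x ℚ.* x ℚ.* x ℚ.+ y ℚ.* y ℚ.* y → ν (x ∷ y ∷ []) ≡ 0ℚ
square≡sumOfCubes⇒ν≡0 x y h = begin
  (x ℚ.+ (y ℚ.+ 0ℚ)) ℚ.* (x ℚ.+ (y ℚ.+ 0ℚ)) ℚ.- (x³ ℚ.+ (y³ ℚ.+ 0ℚ))
    ≡⟨ cong₂ (λ t c → t ℚ.* t ℚ.- (x³ ℚ.+ c)) (cong (x ℚ.+_) (ℚ.+-identityʳ y)) (ℚ.+-identityʳ y³) ⟩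
  s² ℚ.- (x³ ℚ.+ y³) ≡⟨ cong (λ c → s² ℚ.- c) (sym h) ⟩
  s² ℚ.- s²          ≡⟨ ℚ.+-inverseʳ s² ⟩
  0ℚ                 ∎
  where
  open ≡-Reasoning
  s² = (x ℚ.+ y) ℚ.* (x ℚ.+ y)
  x³ = x ℚ.* x ℚ.* x
  y³ = y ℚ.* y ℚ.* y

toℚᵘ-cube : ∀ p → ℚ.toℚᵘ (p ℚ.* p ℚ.* p) ℚᵘ.≃ ℚ.toℚᵘ p ℚᵘ.* ℚ.toℚᵘ p ℚᵘ.* ℚ.toℚᵘ p
toℚᵘ-cube p = ℚᵘ.≃-trans (ℚ.toℚᵘ-homo-* (p ℚ.* p) p) (ℚᵘ.*-congʳ (ℚ.toℚᵘ-homo-* p p))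

toℚᵘ-cancel-square≡sumOfCubes : ∀ x y → let X = ℚ.toℚᵘ x ; Y = ℚ.toℚᵘ y in
  (X ℚᵘ.+ Y) ℚᵘ.* (X ℚᵘ.+ Y) ℚᵘ.≃ X ℚᵘ.* X ℚᵘ.* X ℚᵘ.+ Y ℚᵘ.* Y ℚᵘ.* Y →
  (x ℚ.+ y) ℚ.* (x ℚ.+ y) ≡ x ℚ.* x ℚ.* x ℚ.+ y ℚ.* y ℚ.* y
toℚᵘ-cancel-square≡sumOfCubes x y h = ℚ.toℚᵘ-injective (begin
  ℚ.toℚᵘ ((x ℚ.+ y) ℚ.* (x ℚ.+ y))                ≈⟨ ℚ.toℚᵘ-homo-* (x ℚ.+ y) (x ℚ.+ y) ⟩
  ℚ.toℚᵘ (x ℚ.+ y) ℚᵘ.* ℚ.toℚᵘ (x ℚ.+ y)          ≈⟨ ℚᵘ.*-cong (ℚ.toℚᵘ-homo-+ x y) (ℚ.toℚᵘ-homo-+ x y) ⟩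
  (X ℚᵘ.+ Y) ℚᵘ.* (X ℚᵘ.+ Y)                      ≈⟨ h ⟩
  X ℚᵘ.* X ℚᵘ.* X ℚᵘ.+ Y ℚᵘ.* Y ℚᵘ.* Y            ≈⟨ ℚᵘ.+-cong (toℚᵘ-cube x) (toℚᵘ-cube y) ⟨
  ℚ.toℚᵘ (x ℚ.* x ℚ.* x) ℚᵘ.+ ℚ.toℚᵘ (y ℚ.* y ℚ.* y) ≈⟨ ℚ.toℚᵘ-homo-+ (x ℚ.* x ℚ.* x) (y ℚ.* y ℚ.* y) ⟨
  ℚ.toℚᵘ (x ℚ.* x ℚ.* x ℚ.+ y ℚ.* y ℚ.* y)        ∎)
  where
  open ℚᵘ.≃-Reasoning
  X = ℚ.toℚᵘ x
  Y = ℚ.toℚᵘ y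

pos-*³ : ∀ u v w → + (u ℕ.* v ℕ.* w) ≡ + u ℤ.* + v ℤ.* + w
pos-*³ u v w = trans (ℤ.pos-* (u ℕ.* v) w) (cong (ℤ._* + w) (ℤ.pos-* u v))

fraction-square≡sumOfCubes : ∀ a b m →
  (a ℕ.+ b) ℕ.* (a ℕ.+ b) ℕ.* suc m ≡ a ℕ.* a ℕ.* a ℕ.+ b ℕ.* b ℕ.* b →
  let x = ℚᵘ.mkℚᵘ (+ a) m ; y = ℚᵘ.mkℚᵘ (+ b) m in
  (x ℚᵘ.+ y) ℚᵘ.* (x ℚᵘ.+ y) ℚᵘ.≃ x ℚᵘ.* x ℚᵘ.* x ℚᵘ.+ y ℚᵘ.* y ℚᵘ.* y
fraction-square≡sumOfCubes a b m h = ℚᵘ.*≡* (crossMultiplied (+ a) (+ b) (+ suc m) lifted)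
  where
  lifted : (+ a ℤ.+ + b) ℤ.* (+ a ℤ.+ + b) ℤ.* + suc m ≡ + a ℤ.* + a ℤ.* + a ℤ.+ + b ℤ.* + b ℤ.* + b
  lifted = trans (sym (pos-*³ (a ℕ.+ b) (a ℕ.+ b) (suc m)))
                 (trans (cong +_ h) (cong₂ ℤ._+_ (pos-*³ a a a) (pos-*³ b b b)))

  open ℤ-Solver.+-*-Solver
  open import Data.Integer.Base using (_+_; _*_)
  crossMultiplied : ∀ a b s → (a + b) * (a + b) * s ≡ a * a * a + b * b * b →
    ((a * s + b * s) * (a * s + b * s)) * ((s * s * s) * (s * s * s))
      ≡ ((a * a * a) * (s * s * s) + (b * b * b) * (s * s * s)) * ((s * s) * (s * s))
  crossMultiplied a b s e = begin
    ((a * s + b * s) * (a * s + b * s)) * ((s * s * s) * (s * s * s))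
      ≡⟨ solve 3 (λ a b s →
           ((a :* s :+ b :* s) :* (a :* s :+ b :* s)) :* ((s :* s :* s) :* (s :* s :* s))
             := s⁷ s :* ((a :+ b) :* (a :+ b) :* s)) refl a b s ⟩
    s * s * s * s * s * s * s * ((a + b) * (a + b) * s)
      ≡⟨ cong (s * s * s * s * s * s * s *_) e ⟩
    s * s * s * s * s * s * s * (a * a * a + b * b * b)
      ≡⟨ solve 3 (λ a b s →
           s⁷ s :* (a :* a :* a :+ b :* b :* b)
             := ((a :* a :* a) :* (s :* s :* s) :+ (b :* b :* b) :* (s :* s :* s)) :* ((s :* s) :* (s :* s)))
           refl a b s ⟩
    ((a * a * a) * (s * s * s) + (b * b * b) * (s * s * s)) * ((s * s) * (s * s)) ∎
    where
    open ≡-Reasoning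
    s⁷ : ∀ {n} → Polynomial n → Polynomial n
    s⁷ s = s :* s :* s :* s :* s :* s :* s

hex : ℕ → ℕ
hex k = suc (3 ℕ.* k ℕ.* suc k)

num₁ num₂ : ℕ → ℕ
num₁ k = 2 ℕ.* hex k ℕ.+ k
num₂ k = suc (2 ℕ.* k) ℕ.* suc (3 ℕ.* k)

num-square≡sumOfCubes : ∀ k → (num₁ k ℕ.+ num₂ k) ℕ.* (num₁ k ℕ.+ num₂ k) ℕ.* hex k
                            ≡ num₁ k ℕ.* num₁ k ℕ.* num₁ k ℕ.+ num₂ k ℕ.* num₂ k ℕ.* num₂ k
num-square≡sumOfCubes = solve 1 (λ k →
  let D = con 1 :+ con 3 :* k :* (con 1 :+ k)
      A = con 2 :* D :+ k
      B = (con 1 :+ con 2 :* k) :* (con 1 :+ con 3 :* k)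
  in (A :+ B) :* (A :+ B) :* D := A :* A :* A :+ B :* B :* B) refl
  where open ℕ-Solver.+-*-Solver

num₂+1+k≡2*hex : ∀ k → num₂ k ℕ.+ suc k ≡ 2 ℕ.* hex k
num₂+1+k≡2*hex = solve 1 (λ k →
  (con 1 :+ con 2 :* k) :* (con 1 :+ con 3 :* k) :+ (con 1 :+ k)
    := con 2 :* (con 1 :+ con 3 :* k :* (con 1 :+ k))) refl
  where open ℕ-Solver.+-*-Solver

coprime-hex : ∀ {n} k → (∀ {d} → d ∣ n → d ∣ hex k → d ∣ 3 ℕ.* k ℕ.* suc k) → Coprime n (hex k)
coprime-hex k common {d} (d∣n , d∣hex) =
  ∣1⇒≡1 (∣m+n∣m⇒∣n (subst (d ∣_) (ℕ.+-comm 1 _) d∣hex) (common d∣n d∣hex))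

num₁-coprime : ∀ k → Coprime (num₁ k) (hex k)
num₁-coprime k = coprime-hex k λ d∣num₁ d∣hex →
  ∣m⇒∣m*n (suc k) (∣n⇒∣m*n 3 (∣m+n∣m⇒∣n d∣num₁ (∣n⇒∣m*n 2 d∣hex)))

num₂-coprime : ∀ k → Coprime (num₂ k) (hex k)
num₂-coprime k = coprime-hex k λ {d} d∣num₂ d∣hex →
  ∣n⇒∣m*n (3 ℕ.* k) (∣m+n∣m⇒∣n (subst (d ∣_) (sym (num₂+1+k≡2*hex k)) (∣n⇒∣m*n 2 d∣hex)) d∣num₂)

r₁ r₂ : ℕ → ℚ
r₁ k = ℚ.mkℚ+ (num₁ k) (hex k) (num₁-coprime k)
r₂ k = ℚ.mkℚ+ (num₂ k) (hex k) (num₂-coprime k)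

ν[r₁,r₂]≡0 : ∀ k → ν (r₁ k ∷ r₂ k ∷ []) ≡ 0ℚ
ν[r₁,r₂]≡0 k = square≡sumOfCubes⇒ν≡0 (r₁ k) (r₂ k) (toℚᵘ-cancel-square≡sumOfCubes (r₁ k) (r₂ k)
  (fraction-square≡sumOfCubes (num₁ k) (num₂ k) (3 ℕ.* k ℕ.* suc k) (num-square≡sumOfCubes k)))

coprimeTo-1 : ∀ n → Coprime n 1
coprimeTo-1 n = Coprime.sym (Coprime.1-coprimeTo n)

denominator-1[i/1]≡0 : ∀ i → ℚ.denominator-1 (i / 1) ≡ 0
denominator-1[i/1]≡0 (+ n) = cong ℚ.denominator-1 (ℚ.normalize-coprime (coprimeTo-1 n))
denominator-1[i/1]≡0 ℤ.-[1+ n ] =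
  cong (λ p → ℚ.denominator-1 (ℚ.- p)) (ℚ.normalize-coprime (coprimeTo-1 (suc n)))

denominator-1≢0⇒nonInteger : ∀ p → ¬ ℚ.denominator-1 p ≡ 0 → ¬ ∃ λ (i : ℤ) → p ≡ i / 1
denominator-1≢0⇒nonInteger p d≢0 (i , p≡i/1) =
  d≢0 (trans (cong ℚ.denominator-1 p≡i/1) (denominator-1[i/1]≡0 i))

<-/1 : ∀ q {n} → ∣ ℚ.numerator q ∣ ℕ.< n → q < + n / 1
<-/1 q {n} lt = ℚ.<-respʳ-≡ (sym (ℚ.normalize-coprime (coprimeTo-1 n))) (<-mkℚ q lt)
  where
  <-mkℚ : ∀ q → ∣ ℚ.numerator q ∣ ℕ.< n → q < ℚ.mkℚ (+ n) 0 (coprimeTo-1 n)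
  <-mkℚ (ℚ.mkℚ (+ m) d _) m<n = ℚ.*<* (subst₂ ℤ._<_ (sym (ℤ.*-identityʳ (+ m))) (ℤ.pos-* n (suc d))
    (ℤ.+<+ (ℕ.<-≤-trans m<n (ℕ.m≤m*n n (suc d)))))
  <-mkℚ (ℚ.mkℚ ℤ.-[1+ m ] d _) (ℕ.s≤s _) = ℚ.*<* ℤ.-<+

k<hex : ∀ k → k ℕ.< hex k
k<hex k = ℕ.s≤s (ℕ.≤-trans (ℕ.m≤n*m k 3) (ℕ.m≤m*n (3 ℕ.* k) (suc k)))

mainTheorem11 : (Q : ℚ) → 0ℚ < Q →
    Σ (List ℚ) λ σ → All (λ a → 0ℚ < a) σ × ν σ ≡ 0ℚ ×
    Σ ℚ λ x → x ∈ σ × (¬ ∃ λ (n : ℤ) → x ≡ n / 1) ×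
    Σ ℤ λ p → Σ ℕ λ q → Σ (NonZero q) λ nz →
    Coprime ∣ p ∣ q × x ≡ (p / q) {{nz}} × Q < (+ q) / 1
mainTheorem11 Q _ =
  r₁ k ∷ r₂ k ∷ [] , ℚ.positive⁻¹ (r₁ k) All.∷ ℚ.positive⁻¹ (r₂ k) All.∷ All.[] , ν[r₁,r₂]≡0 k ,
  r₁ k , here refl , denominator-1≢0⇒nonInteger (r₁ k) (λ ()) ,
  + num₁ k , hex k , _ , num₁-coprime k , sym (ℚ.normalize-coprime (num₁-coprime k)) ,
  <-/1 Q (ℕ.<-trans (ℕ.n<1+n n) (k<hex k))
  where
  n = ∣ ℚ.numerator Q ∣
  -- k ≥ 1 makes hex k > 1, which is what refutes integrality of r₁ k via (λ ()).
  k = suc n
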